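{- Let $m\geq2$ be an integer and $\lambda=\frac2m$. If $m\not\equiv1\pmod3$, then there is $P$ such that \[\frac{f_\lambda(p)}{p}\geq m+2-\frac2p\] for all $p\in D_\lambda$ with $p>P$. If $m\equiv1\pmod 3$, this inequality holds for all sufficiently large isolated primes $p\in D_\lambda$.
   Context: For a prime $p$ and real $\lambda>0$, $I_\lambda(p)=[p,p+\lambda p]$; $D_\lambda$ is the set of primes $p$ such that $I_\lambda(p)$ contains at least two primes; for $p\in D_\lambda$, $f_\lambda(p)$ is the largest integer that is not a finite sum of primes from $I_\lambda(p)$ (the Frobenius number of the numerical semigroup generated by these primes). A prime $p$ is isolated if neither $p-2$ nor $p+2$ is prime. -}

module Defs where

open import Data.Nat using (ℕ; _+_; _*_; _∸_; _≤_; _<_)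
open import Data.Nat.Primality using (Prime)
open import Data.List using (List)
open import Data.Nat.ListAction using (sum)
open import Data.List.Relation.Unary.All using (All)
open import Data.Product using (_×_; ∃-syntax)
open import Relation.Nullary using (¬_)
open import Relation.Binary.PropositionalEquality using (_≡_; _≢_)

-- Throughout, λ = 2/m with m ≥ 1 a natural number.
-- q ∈ I_λ(p) = [p, p + (2/m) p]  and q prime.
-- p ≤ q ≤ p + 2p/m  ⟺  p ≤ q  and  m*q ≤ m*p + 2*p  (m > 0).
InI : ℕ → ℕ → ℕ → Set
InI m p q = Prime q × p ≤ q × m * q ≤ m * p + 2 * p

InD : ℕ → ℕ → Set
InD m p = Prime p × ∃[ q ] ∃[ r ] (q ≢ r × InI m p q × InI m p r)

Representable : ℕ → ℕ → ℕ → Set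
Representable m p n = ∃[ xs ] (All (InI m p) xs × sum xs ≡ n)

IsFrobenius : ℕ → ℕ → ℕ → Set
IsFrobenius m p F = ¬ Representable m p F × (∀ n → F < n → Representable m p n)

Isolated : ℕ → Set
Isolated p = Prime p × ¬ Prime (p ∸ 2) × ¬ Prime (p + 2)

-- Put c = (m + 2) p, so that a prime q lies in I_λ(p) iff p ≤ q and m q ≤ c.  A sum of k such
-- primes is at least k p, at most k c / m, and has the parity of k, while c ≡ m (mod 2).
-- If p + 2 is composite, c + 2 is not representable: k ≤ m summands are too small, k = m + 1
-- has the wrong parity, k = m + 2 gives either exactly c or at least c + 4 (every other prime
-- of the interval is at least p + 4), and more summands are too large.  If p + 2 is prime then
-- p ≡ 2 (mod 3), and for m ≢ 1 (mod 3) the values m q = c, c − 1, c − 2 are excluded (p ∣ m q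
-- would force q = p; parity; residues mod 3), so m q ≤ c − 3 and the same count shows that
-- c − 2 is not representable.
module Submission where

open import Defs
open import Data.Nat using (ℕ; _+_; _*_; _%_; _≤_; _<_)
open import Data.Product using (_×_; ∃-syntax)
open import Relation.Nullary using (¬_)
open import Relation.Binary.PropositionalEquality using (_≡_)

open import Data.Nat using (zero; suc; _∸_; NonZero; NonTrivial; z≤n; s≤s; z<s; >-nonZero)
open import Data.Nat.Properties
open import Data.Nat.DivMod using (%-distribˡ-+; %-distribˡ-*; m%n<n; m%n%n≡m%n; [m+n]%n≡m%n)
open import Data.Nat.Divisibility using (divides; ∣⇒≤; m%n≡0⇒n∣m; hasNonTrivialDivisor)
open import Data.Nat.Primality using (Prime; prime?; prime⇒irreducible; prime⇒nonZero; euclidsLemma)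
open import Data.Nat.ListAction using (sum)
open import Data.List using (List; []; _∷_; length)
open import Data.List.Relation.Unary.All as All using (All; []; _∷_)
open import Data.Product using (_,_)
open import Data.Sum using (_⊎_; inj₁; inj₂)
import Data.Sum as Sum
open import Data.Empty using (⊥-elim)
open import Relation.Nullary using (yes; no)
open import Relation.Binary.PropositionalEquality using (_≢_; refl; sym; trans; cong; cong₂; subst; subst₂)
open import Relation.Binary.PropositionalEquality using (module ≡-Reasoning)

%-cong-+ : ∀ {n} .{{_ : NonZero n}} {a b c d} →
           a % n ≡ b % n → c % n ≡ d % n → (a + c) % n ≡ (b + d) % n
%-cong-+ {n} {a} {b} {c} {d} a≡b c≡d = begin
  (a + c) % n          ≡⟨ %-distribˡ-+ a c n ⟩
  (a % n + c % n) % n  ≡⟨ cong₂ (λ x y → (x + y) % n) a≡b c≡d ⟩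
  (b % n + d % n) % n  ≡⟨ %-distribˡ-+ b d n ⟨
  (b + d) % n          ∎
  where open ≡-Reasoning

%-cong-* : ∀ {n} .{{_ : NonZero n}} {a b c d} →
           a % n ≡ b % n → c % n ≡ d % n → (a * c) % n ≡ (b * d) % n
%-cong-* {n} {a} {b} {c} {d} a≡b c≡d = begin
  (a * c) % n            ≡⟨ %-distribˡ-* a c n ⟩
  (a % n * (c % n)) % n  ≡⟨ cong₂ (λ x y → (x * y) % n) a≡b c≡d ⟩
  (b % n * (d % n)) % n  ≡⟨ %-distribˡ-* b d n ⟨
  (b * d) % n            ∎
  where open ≡-Reasoning

[n+1]%2≢n%2 : ∀ n → (n + 1) % 2 ≢ n % 2
[n+1]%2≢n%2 zero ()
[n+1]%2≢n%2 (suc zero) ()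
[n+1]%2≢n%2 (suc (suc n)) = [n+1]%2≢n%2 n

*-odd-%2 : ∀ a {x} → x % 2 ≡ 1 → (a * x) % 2 ≡ a % 2
*-odd-%2 a {x} x-odd = trans (%-cong-* {a = a} {b = a} {c = x} {d = 1} refl x-odd) (cong (_% 2) (*-identityʳ a))

[n+d]%2≡n%2⇒d≡0⊎d≡2⊎4≤d : ∀ n d → (n + d) % 2 ≡ n % 2 → d ≡ 0 ⊎ d ≡ 2 ⊎ 4 ≤ d
[n+d]%2≡n%2⇒d≡0⊎d≡2⊎4≤d n 0 _ = inj₁ refl
[n+d]%2≡n%2⇒d≡0⊎d≡2⊎4≤d n 1 eq = ⊥-elim ([n+1]%2≢n%2 n eq)
[n+d]%2≡n%2⇒d≡0⊎d≡2⊎4≤d n 2 _ = inj₂ (inj₁ refl)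
[n+d]%2≡n%2⇒d≡0⊎d≡2⊎4≤d n 3 eq = ⊥-elim ([n+1]%2≢n%2 n (begin
  (n + 1) % 2        ≡⟨ [m+n]%n≡m%n (n + 1) 2 ⟨
  (n + 1 + 2) % 2    ≡⟨ cong (_% 2) (+-assoc n 1 2) ⟩
  (n + 3) % 2        ≡⟨ eq ⟩
  n % 2              ∎))
  where open ≡-Reasoning
[n+d]%2≡n%2⇒d≡0⊎d≡2⊎4≤d n (suc (suc (suc (suc d)))) _ = inj₂ (inj₂ (m≤m+n 4 d))

-- r = m % 3 and s = x % 3 in  m x + 2 = (m + 2) p,  where p % 3 = 2.
residue-obstruction : ∀ r s → r < 3 → s < 3 → r ≢ 1 → s ≢ 0 →
                      (r * s + 2) % 3 ≢ ((r + 2) * 2) % 3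
residue-obstruction 0 _ _ _ _ _ ()
residue-obstruction 1 _ _ _ r≢1 _ _ = r≢1 refl
residue-obstruction 2 0 _ _ _ s≢0 _ = s≢0 refl
residue-obstruction 2 1 _ _ _ _ ()
residue-obstruction 2 2 _ _ _ _ ()
residue-obstruction 2 (suc (suc (suc _))) _ (s≤s (s≤s (s≤s ()))) _ _ _
residue-obstruction (suc (suc (suc _))) _ (s≤s (s≤s (s≤s ()))) _ _ _ _

n≤m⊎n≡m+1⊎m+2≤n : ∀ n m → n ≤ m ⊎ n ≡ m + 1 ⊎ m + 2 ≤ n
n≤m⊎n≡m+1⊎m+2≤n zero m = inj₁ z≤n
n≤m⊎n≡m+1⊎m+2≤n (suc zero) zero = inj₂ (inj₁ refl)
n≤m⊎n≡m+1⊎m+2≤n (suc (suc n)) zero = inj₂ (inj₂ (s≤s (s≤s z≤n)))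
n≤m⊎n≡m+1⊎m+2≤n (suc n) (suc m) = Sum.map s≤s (Sum.map (cong suc) s≤s) (n≤m⊎n≡m+1⊎m+2≤n n m)

prime⇒%≢0 : ∀ {x} d .{{_ : NonZero d}} .{{_ : NonTrivial d}} → d < x → Prime x → x % d ≢ 0
prime⇒%≢0 {x} d d<x x-prime x%d≡0 =
  Prime.notComposite x-prime (hasNonTrivialDivisor d<x (m%n≡0⇒n∣m x d x%d≡0))

prime⇒odd : ∀ {x} → 2 < x → Prime x → x % 2 ≡ 1
prime⇒odd {x} 2<x x-prime with x % 2 in x%2 | m%n<n x 2
... | 0 | _ = ⊥-elim (prime⇒%≢0 2 2<x x-prime x%2)
... | 1 | _ = refl
... | suc (suc _) | s≤s (s≤s ())

twin-prime⇒%3≡2 : ∀ {p} → 3 < p → Prime p → Prime (p + 2) → p % 3 ≡ 2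
twin-prime⇒%3≡2 {p} 3<p p-prime p+2-prime with p % 3 in p%3 | m%n<n p 3
... | 0 | _ = ⊥-elim (prime⇒%≢0 3 3<p p-prime p%3)
... | 1 | _ = ⊥-elim (prime⇒%≢0 3 (≤-trans 3<p (m≤m+n p 2)) p+2-prime
                      (%-cong-+ {a = p} {b = 1} {c = 2} {d = 2} p%3 refl))
... | 2 | _ = refl
... | suc (suc (suc _)) | s≤s (s≤s (s≤s ()))

sum-≥ : ∀ {n} {xs : List ℕ} → All (n ≤_) xs → length xs * n ≤ sum xs
sum-≥ [] = z≤n
sum-≥ (n≤x ∷ n≤xs) = +-mono-≤ n≤x (sum-≥ n≤xs)

*-sum-≤ : ∀ m {b} {xs : List ℕ} → All (λ x → m * x ≤ b) xs → m * sum xs ≤ length xs * b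
*-sum-≤ m [] = ≤-reflexive (*-zeroʳ m)
*-sum-≤ m {xs = x ∷ xs} (mx≤b ∷ mxs≤b) =
  ≤-trans (≤-reflexive (*-distribˡ-+ m x (sum xs))) (+-mono-≤ mx≤b (*-sum-≤ m mxs≤b))

length≤⇒sum≤ : ∀ m {b} .{{_ : NonZero m}} {xs : List ℕ} →
               length xs ≤ m → All (λ x → m * x ≤ b) xs → sum xs ≤ b
length≤⇒sum≤ m {b} k≤m mxs≤b = *-cancelˡ-≤ m (≤-trans (*-sum-≤ m mxs≤b) (*-monoˡ-≤ b k≤m))

sum-odd-%2 : ∀ {xs : List ℕ} → All (λ x → x % 2 ≡ 1) xs → sum xs % 2 ≡ length xs % 2
sum-odd-%2 [] = refl
sum-odd-%2 {x ∷ xs} (x-odd ∷ xs-odd) =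
  %-cong-+ {a = x} {b = 1} {c = sum xs} {d = length xs} x-odd (sum-odd-%2 xs-odd)

sum-gap : ∀ {n d} {xs : List ℕ} → All (λ x → x ≡ n ⊎ n + d ≤ x) xs →
          sum xs ≡ length xs * n ⊎ length xs * n + d ≤ sum xs
sum-gap [] = inj₁ refl
sum-gap {n} {d} {x ∷ xs} (x-gap ∷ xs-gap) with x-gap | sum-gap xs-gap
... | inj₁ refl | inj₁ S≡kn = inj₁ (cong (n +_) S≡kn)
... | inj₁ refl | inj₂ kn+d≤S = inj₂ (≤-trans (≤-reflexive (+-assoc n _ d)) (+-monoʳ-≤ n kn+d≤S))
... | inj₂ n+d≤x | ih = inj₂ (≤-trans (≤-reflexive (+-comm-middle n _ d)) (+-mono-≤ n+d≤x (kn≤S ih)))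
  where
  kn≤S : ∀ {k S} → S ≡ k ⊎ k + d ≤ S → k ≤ S
  kn≤S (inj₁ refl) = ≤-refl
  kn≤S (inj₂ k+d≤S) = ≤-trans (m≤m+n _ d) k+d≤S
  +-comm-middle : ∀ a b c → a + b + c ≡ a + c + b
  +-comm-middle a b c = trans (+-assoc a b c) (trans (cong (a +_) (+-comm b c)) (sym (+-assoc a c b)))

frobenius-≥ : ∀ {m p F n} → IsFrobenius m p F → ¬ Representable m p n → n ≤ F
frobenius-≥ (_ , above-representable) ¬rep = ≮⇒≥ (λ F<n → ¬rep (above-representable _ F<n))

module FrobeniusBound {m p : ℕ} .{{_ : NonZero m}} (m<p : m < p) (3<p : 3 < p) (p-prime : Prime p) where

  c : ℕ
  c = (m + 2) * p

  2<p : 2 < p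
  2<p = <⇒≤ 3<p

  3≤c : 3 ≤ c
  3≤c = ≤-trans (<⇒≤ 3<p) (≤-trans (m≤m+n p (p + 0)) (*-monoˡ-≤ p (m≤n+m 2 m)))

  2≤c : 2 ≤ c
  2≤c = <⇒≤ 3≤c

  lower : ∀ {x} → InI m p x → p ≤ x
  lower (_ , p≤x , _) = p≤x

  upper : ∀ {x} → InI m p x → m * x ≤ c
  upper {x} (_ , _ , mx≤) = subst (m * x ≤_) (sym (*-distribʳ-+ p m 2)) mx≤

  odd : ∀ {x} → InI m p x → x % 2 ≡ 1
  odd (x-prime , p≤x , _) = prime⇒odd (<-≤-trans 2<p p≤x) x-prime

  c%2≡m%2 : c % 2 ≡ m % 2
  c%2≡m%2 = trans (*-odd-%2 (m + 2) (prime⇒odd 2<p p-prime)) ([m+n]%n≡m%n m 2)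

  length≥⇒sum≥ : ∀ {k xs} → All (InI m p) xs → k ≤ length xs → k * p ≤ sum xs
  length≥⇒sum≥ xs-in k≤length = ≤-trans (*-monoˡ-≤ p k≤length) (sum-≥ (All.map lower xs-in))

  m+1-summands⇒%2≢m%2 : ∀ {xs} → All (InI m p) xs → length xs ≡ m + 1 → sum xs % 2 ≢ m % 2
  m+1-summands⇒%2≢m%2 {xs} xs-in length≡ S%2≡m%2 = [n+1]%2≢n%2 m (begin
    (m + 1) % 2       ≡⟨ cong (_% 2) length≡ ⟨
    length xs % 2     ≡⟨ sum-odd-%2 (All.map odd xs-in) ⟨
    sum xs % 2        ≡⟨ S%2≡m%2 ⟩
    m % 2             ∎)
    where open ≡-Reasoning

  module NonTwin (p+2-composite : ¬ Prime (p + 2)) where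

    element-gap : ∀ {x} → InI m p x → x ≡ p ⊎ p + 4 ≤ x
    element-gap x-in@(x-prime , p≤x , _) with m≤n⇒∃[o]m+o≡n p≤x
    ... | d , refl with [n+d]%2≡n%2⇒d≡0⊎d≡2⊎4≤d p d (trans (odd x-in) (sym (prime⇒odd 2<p p-prime)))
    ...   | inj₁ refl = inj₁ (+-identityʳ p)
    ...   | inj₂ (inj₁ refl) = ⊥-elim (p+2-composite x-prime)
    ...   | inj₂ (inj₂ 4≤d) = inj₂ (+-monoʳ-≤ p 4≤d)

    c+2-not-representable : ¬ Representable m p (c + 2)
    c+2-not-representable (xs , xs-in , S≡c+2) with n≤m⊎n≡m+1⊎m+2≤n (length xs) m
    ... | inj₁ k≤m =
      <⇒≱ (m<m+n c z<s) (subst (_≤ c) S≡c+2 (length≤⇒sum≤ m k≤m (All.map upper xs-in)))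
    ... | inj₂ (inj₁ k≡m+1) =
      m+1-summands⇒%2≢m%2 xs-in k≡m+1 (trans (cong (_% 2) S≡c+2) (trans ([m+n]%n≡m%n c 2) c%2≡m%2))
    ... | inj₂ (inj₂ m+2≤k) with m≤n⇒m<n∨m≡n m+2≤k
    ...   | inj₁ m+3≤k =
      <⇒≱ (+-monoʳ-< c 2<p) (subst₂ _≤_ (+-comm p c) S≡c+2 (length≥⇒sum≥ xs-in m+3≤k))
    ...   | inj₂ m+2≡k with sum-gap (All.map element-gap xs-in)
    ...     | inj₁ S≡kp = <⇒≢ (m<m+n c z<s) (trans (sym kp≡c) (trans (sym S≡kp) S≡c+2))
      where
      kp≡c : length xs * p ≡ c
      kp≡c = cong (_* p) (sym m+2≡k)
    ...     | inj₂ kp+4≤S =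
      <⇒≱ (+-monoʳ-< c (s≤s (s≤s (s≤s z≤n))))
        (subst₂ _≤_ (cong (λ k → k * p + 4) (sym m+2≡k)) S≡c+2 kp+4≤S)

    frobenius-bound : ∀ {F} → IsFrobenius m p F → c ≤ F + 2
    frobenius-bound {F} F-frobenius =
      ≤-trans (m≤m+n c 2)
        (≤-trans (frobenius-≥ {m} {p} F-frobenius c+2-not-representable) (m≤m+n F 2))

  module Twin (p+2-prime : Prime (p + 2)) (m%3≢1 : m % 3 ≢ 1) where

    m*x≢c : ∀ {x} → InI m p x → m * x ≢ c
    m*x≢c {x} (x-prime , _ , _) mx≡c with euclidsLemma m x p-prime (divides (m + 2) mx≡c)
    ... | inj₁ p∣m = <⇒≱ m<p (∣⇒≤ p∣m)
    ... | inj₂ p∣x with prime⇒irreducible x-prime p∣x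
    ...   | inj₁ p≡1 = <⇒≢ (<-trans (n<1+n 1) 2<p) (sym p≡1)
    ...   | inj₂ refl =
      <⇒≢ (m<m+n m z<s) (*-cancelʳ-≡ m (m + 2) p {{prime⇒nonZero p-prime}} mx≡c)

    m*x+1≢c : ∀ {x} → InI m p x → m * x + 1 ≢ c
    m*x+1≢c {x} x-in mx+1≡c = [n+1]%2≢n%2 m (begin
      (m + 1) % 2      ≡⟨ %-cong-+ {a = m * x} {b = m} {c = 1} {d = 1}
                            (*-odd-%2 m (odd x-in)) refl ⟨
      (m * x + 1) % 2  ≡⟨ cong (_% 2) mx+1≡c ⟩
      c % 2            ≡⟨ c%2≡m%2 ⟩
      m % 2            ∎)
      where open ≡-Reasoning

    m*x+2≢c : ∀ {x} → InI m p x → m * x + 2 ≢ c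
    m*x+2≢c {x} (x-prime , p≤x , _) mx+2≡c =
      residue-obstruction (m % 3) (x % 3) (m%n<n m 3) (m%n<n x 3) m%3≢1
        (prime⇒%≢0 3 (<-≤-trans 3<p p≤x) x-prime) (begin
        (m % 3 * (x % 3) + 2) % 3  ≡⟨ %-cong-+ {a = m % 3 * (x % 3)} {b = m * x} {c = 2} {d = 2}
                                        (%-cong-* {a = m % 3} {b = m} {c = x % 3} {d = x}
                                          (m%n%n≡m%n m 3) (m%n%n≡m%n x 3))
                                        refl ⟩
        (m * x + 2) % 3            ≡⟨ cong (_% 3) mx+2≡c ⟩
        c % 3                      ≡⟨ %-cong-* {a = m + 2} {b = m % 3 + 2} {c = p} {d = 2}
                                        (%-cong-+ {a = m} {b = m % 3} {c = 2} {d = 2}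
                                          (sym (m%n%n≡m%n m 3)) refl)
                                        (twin-prime⇒%3≡2 3<p p-prime p+2-prime) ⟩
        ((m % 3 + 2) * 2) % 3      ∎)
      where open ≡-Reasoning

    element-upper : ∀ {x} → InI m p x → m * x ≤ c ∸ 3
    element-upper {x} x-in with m≤n⇒∃[o]m+o≡n (upper x-in)
    ... | 0 , mx+0≡c = ⊥-elim (m*x≢c x-in (trans (sym (+-identityʳ (m * x))) mx+0≡c))
    ... | 1 , mx+1≡c = ⊥-elim (m*x+1≢c x-in mx+1≡c)
    ... | 2 , mx+2≡c = ⊥-elim (m*x+2≢c x-in mx+2≡c)
    ... | suc (suc (suc d)) , mx+3+d≡c =
      m+n≤o⇒m≤o∸n (m * x) (≤-trans (+-monoʳ-≤ (m * x) (m≤m+n 3 d)) (≤-reflexive mx+3+d≡c))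

    c∸2-not-representable : ¬ Representable m p (c ∸ 2)
    c∸2-not-representable (xs , xs-in , S≡c∸2) with n≤m⊎n≡m+1⊎m+2≤n (length xs) m
    ... | inj₁ k≤m =
      <⇒≱ (∸-monoʳ-< (n<1+n 2) 3≤c)
        (subst (_≤ c ∸ 3) S≡c∸2 (length≤⇒sum≤ m k≤m (All.map element-upper xs-in)))
    ... | inj₂ (inj₁ k≡m+1) = m+1-summands⇒%2≢m%2 xs-in k≡m+1 (begin
      sum xs % 2         ≡⟨ cong (_% 2) S≡c∸2 ⟩
      (c ∸ 2) % 2        ≡⟨ [m+n]%n≡m%n (c ∸ 2) 2 ⟨
      (c ∸ 2 + 2) % 2    ≡⟨ cong (_% 2) (m∸n+n≡m 2≤c) ⟩
      c % 2              ≡⟨ c%2≡m%2 ⟩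
      m % 2              ∎)
      where open ≡-Reasoning
    ... | inj₂ (inj₂ m+2≤k) =
      <⇒≱ (∸-monoʳ-< z<s 2≤c) (subst (c ≤_) S≡c∸2 (length≥⇒sum≥ xs-in m+2≤k))

    frobenius-bound : ∀ {F} → IsFrobenius m p F → c ≤ F + 2
    frobenius-bound {F} F-frobenius =
      ≤-trans (m≤n+m∸n c 2)
        (≤-trans (+-monoʳ-≤ 2 (frobenius-≥ {m} {p} F-frobenius c∸2-not-representable))
          (≤-reflexive (+-comm 2 F)))

-- Membership in D_λ is only needed for the Frobenius number to exist; since F is given,
-- only the primality of p is used.
proposition2p4 : (m : ℕ) → 2 ≤ m →
    ((¬ (m % 3 ≡ 1)) →
    ∃[ P ] ((p : ℕ) → InD m p → P < p →
    (F : ℕ) → IsFrobenius m p F → (m + 2) * p ≤ F + 2))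
    × (m % 3 ≡ 1 →
    ∃[ P ] ((p : ℕ) → InD m p → Isolated p → P < p →
    (F : ℕ) → IsFrobenius m p F → (m + 2) * p ≤ F + 2))
proposition2p4 m 2≤m =
  (λ m%3≢1 → m + 3 , bound-for-m%3≢1 m%3≢1) , (λ _ → m + 3 , bound-for-isolated)
  where
  instance
    m-nonZero : NonZero m
    m-nonZero = >-nonZero (<-≤-trans z<s 2≤m)

  module Large {p} (m+3<p : m + 3 < p) =
    FrobeniusBound {m} {p} (<-≤-trans (m<m+n m z<s) (<⇒≤ m+3<p)) (≤-<-trans (m≤n+m 3 m) m+3<p)

  bound-for-m%3≢1 : ¬ m % 3 ≡ 1 → ∀ p → InD m p → m + 3 < p →
                    ∀ F → IsFrobenius m p F → (m + 2) * p ≤ F + 2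
  bound-for-m%3≢1 m%3≢1 p (p-prime , _) m+3<p F F-frobenius with prime? (p + 2)
  ... | yes p+2-prime = Large.Twin.frobenius-bound m+3<p p-prime p+2-prime m%3≢1 F-frobenius
  ... | no p+2-composite = Large.NonTwin.frobenius-bound m+3<p p-prime p+2-composite F-frobenius

  bound-for-isolated : ∀ p → InD m p → Isolated p → m + 3 < p →
                       ∀ F → IsFrobenius m p F → (m + 2) * p ≤ F + 2
  bound-for-isolated p (p-prime , _) (_ , _ , p+2-composite) m+3<p F F-frobenius =
    Large.NonTwin.frobenius-bound m+3<p p-prime p+2-composite F-frobenius
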